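{- Let $\Gamma$ be a set of formulas and $A$ a formula. (1) If $\Gamma \vdash_{\mathsf{NK}} A$, then $\Gamma^{\mathsf{m}} \vdash_{\mathsf{D}} \lnot\lnot A^{\mathsf{m}}$ and $\Gamma^{\mathsf{m}}, \lnot A^{\mathsf{m}} \vdash_{\mathsf{D}} \bot$, where $\mathsf{D} = \mathsf{NM}\setminus\{\to_\mathsf{i},\to_\mathsf{e},\forall_\mathsf{i},\forall_\mathsf{e}\}$. (2) If $\to$ and $\forall$ occur neither in $A$ nor in any formula of $\Gamma$, then the following are equivalent: (a) $\Gamma\vdash_{\mathsf{NK}} A$; (b) $\Gamma\vdash_{\mathsf{NM}}\lnot\lnot A$; (c) $\Gamma,\lnot A\vdash_{\mathsf{NM}}\bot$. If moreover $A=\lnot B$, then $\Gamma\vdash_{\mathsf{NK}}\lnot B$ if and only if $\Gamma\vdash_{\mathsf{NM}}\lnot B$.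
   Context: First-order language with connectives $\top,\bot,\lnot,\land,\lor,\to$ and quantifiers $\forall,\exists$; negation $\lnot$ is primitive (not an abbreviation of $A\to\bot$). Natural deduction rules: $\mathsf{raa}$ (from $\bot$ infer $A$, discharging any number, possibly zero, of assumptions $\lnot A$); $\mathsf{efq}$ (from $\bot$ infer $A$); $\top_\mathsf{i}$; $\lnot_\mathsf{i}$ (from $\bot$ infer $\lnot A$ discharging $A$); $\lnot_\mathsf{e}$ (from $\lnot A$ and $A$ infer $\bot$); and the usual Prawitz-style rules $\to_\mathsf{i}$, $\to_\mathsf{e}$, $\land_\mathsf{i}$, $\land_{\mathsf{e}_1}$, $\land_{\mathsf{e}_2}$, $\lor_{\mathsf{i}_1}$, $\lor_{\mathsf{i}_2}$, $\lor_\mathsf{e}$, $\forall_\mathsf{i}$, $\forall_\mathsf{e}$, $\exists_\mathsf{i}$, $\exists_\mathsf{e}$ (discharging rules may discharge any number of assumptions). $\mathsf{NM}$ (minimal logic) is the set of all these rules except $\mathsf{raa}$ and $\mathsf{efq}$; $\mathsf{NK}=\mathsf{NM}\cup\{\mathsf{raa}\}$ (classical logic). $\Gamma\vdash_{\mathsf{D}} A$ means there is a derivation using only rules of $\mathsf{D}$, with conclusion $A$, all of whose undischarged assumptions are occurrences of formulas in $\Gamma$. The translation $(\cdot)^{\mathsf{m}}$ is defined by induction: atomic formulas, $\top$, $\bot$ unchanged; $(A\land B)^{\mathsf{m}}=A^{\mathsf{m}}\land B^{\mathsf{m}}$; $(A\lor B)^{\mathsf{m}}=A^{\mathsf{m}}\lor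 B^{\mathsf{m}}$; $(\lnot A)^{\mathsf{m}}=\lnot A^{\mathsf{m}}$; $(A\to B)^{\mathsf{m}}=\lnot A^{\mathsf{m}}\lor B^{\mathsf{m}}$; $(\forall x A)^{\mathsf{m}}=\lnot\exists x\lnot A^{\mathsf{m}}$; $(\exists x A)^{\mathsf{m}}=\exists x A^{\mathsf{m}}$; and $\Gamma^{\mathsf{m}}=\{A^{\mathsf{m}}\mid A\in\Gamma\}$. -}

module Defs where

open import Data.Nat using (ℕ; zero; suc)
open import Data.Vec using (Vec; []; _∷_)
open import Data.Bool using (Bool; true; false; T)
open import Data.Product using (Σ; _×_; _,_)
open import Data.Sum using (_⊎_)
open import Data.Unit using (⊤)
open import Data.Empty using (⊥)
open import Relation.Binary.PropositionalEquality using (_≡_)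

-- A first-order signature: function symbols and predicate symbols with arities
-- (constants are 0-ary function symbols, propositional letters 0-ary predicates).
record Signature : Set₁ where
  field
    FunSym   : Set
    funArity : FunSym → ℕ
    PredSym  : Set
    predArity : PredSym → ℕ

module FOL (S : Signature) where
  open Signature S

  -- Terms with de Bruijn-indexed variables.
  data Term : Set where
    var : ℕ → Term
    fun : (f : FunSym) → Vec Term (funArity f) → Term

  -- Formulas; ∀' and ∃' bind variable 0 in their body. ¬' is primitive.
  infixr 6 _∧'_
  infixr 5 _∨'_
  infixr 4 _⇒_
  data Formula : Set where
    atom : (p : PredSym) → Vec Term (predArity p) → Formula
    ⊤' ⊥' : Formula
    ¬'_ : Formula → Formula
    _∧'_ _∨'_ _⇒_ : Formula → Formula → Formula
    ∀' ∃' : Formula → Formula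

  Subst : Set
  Subst = ℕ → Term

  mutual
    renT : (ℕ → ℕ) → Term → Term
    renT ρ (var x) = var (ρ x)
    renT ρ (fun f ts) = fun f (renTs ρ ts)

    renTs : ∀ {n} → (ℕ → ℕ) → Vec Term n → Vec Term n
    renTs ρ [] = []
    renTs ρ (t ∷ ts) = renT ρ t ∷ renTs ρ ts

  mutual
    subT : Subst → Term → Term
    subT σ (var x) = σ x
    subT σ (fun f ts) = fun f (subTs σ ts)

    subTs : ∀ {n} → Subst → Vec Term n → Vec Term n
    subTs σ [] = []
    subTs σ (t ∷ ts) = subT σ t ∷ subTs σ ts

  liftS : Subst → Subst
  liftS σ zero = var zero
  liftS σ (suc x) = renT suc (σ x)

  subF : Subst → Formula → Formula
  subF σ (atom p ts) = atom p (subTs σ ts)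
  subF σ ⊤' = ⊤'
  subF σ ⊥' = ⊥'
  subF σ (¬' A) = ¬' subF σ A
  subF σ (A ∧' B) = subF σ A ∧' subF σ B
  subF σ (A ∨' B) = subF σ A ∨' subF σ B
  subF σ (A ⇒ B) = subF σ A ⇒ subF σ B
  subF σ (∀' A) = ∀' (subF (liftS σ) A)
  subF σ (∃' A) = ∃' (subF (liftS σ) A)

  shiftF : Formula → Formula
  shiftF = subF (λ x → var (suc x))

  _[_] : Formula → Term → Formula
  A [ t ] = subF σ A
    where
      σ : Subst
      σ zero = t
      σ (suc x) = var x

  FSet : Set₁
  FSet = Formula → Set

  _,,_ : FSet → Formula → FSet
  (Γ ,, A) B = Γ B ⊎ (B ≡ A)

  ↑_ : FSet → FSet
  (↑ Γ) B = Σ Formula λ C → Γ C × (B ≡ shiftF C)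

  data Rule : Set where
    raa efq ⊤i ¬i ¬e →i →e ∧i ∧e₁ ∧e₂ ∨i₁ ∨i₂ ∨e ∀i ∀e ∃i ∃e : Rule

  RuleSet : Set
  RuleSet = Rule → Bool

  -- Discharging rules
  -- extend the set of available assumptions (discharging any number, possibly
  -- zero, of occurrences). Eigenvariable conditions are handled by shifting.
  data _⊢[_]_ : FSet → RuleSet → Formula → Set₁ where
    ass  : ∀ {Γ R A} → Γ A → Γ ⊢[ R ] A
    raaR : ∀ {Γ R A} → T (R raa) → (Γ ,, (¬' A)) ⊢[ R ] ⊥' → Γ ⊢[ R ] A
    efqR : ∀ {Γ R A} → T (R efq) → Γ ⊢[ R ] ⊥' → Γ ⊢[ R ] A
    ⊤iR  : ∀ {Γ R} → T (R ⊤i) → Γ ⊢[ R ] ⊤'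
    ¬iR  : ∀ {Γ R A} → T (R ¬i) → (Γ ,, A) ⊢[ R ] ⊥' → Γ ⊢[ R ] (¬' A)
    ¬eR  : ∀ {Γ R A} → T (R ¬e) → Γ ⊢[ R ] (¬' A) → Γ ⊢[ R ] A → Γ ⊢[ R ] ⊥'
    →iR  : ∀ {Γ R A B} → T (R →i) → (Γ ,, A) ⊢[ R ] B → Γ ⊢[ R ] (A ⇒ B)
    →eR  : ∀ {Γ R A B} → T (R →e) → Γ ⊢[ R ] (A ⇒ B) → Γ ⊢[ R ] A → Γ ⊢[ R ] B
    ∧iR  : ∀ {Γ R A B} → T (R ∧i) → Γ ⊢[ R ] A → Γ ⊢[ R ] B → Γ ⊢[ R ] (A ∧' B)
    ∧e₁R : ∀ {Γ R A B} → T (R ∧e₁) → Γ ⊢[ R ] (A ∧' B) → Γ ⊢[ R ] A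
    ∧e₂R : ∀ {Γ R A B} → T (R ∧e₂) → Γ ⊢[ R ] (A ∧' B) → Γ ⊢[ R ] B
    ∨i₁R : ∀ {Γ R A B} → T (R ∨i₁) → Γ ⊢[ R ] A → Γ ⊢[ R ] (A ∨' B)
    ∨i₂R : ∀ {Γ R A B} → T (R ∨i₂) → Γ ⊢[ R ] B → Γ ⊢[ R ] (A ∨' B)
    ∨eR  : ∀ {Γ R A B C} → T (R ∨e) → Γ ⊢[ R ] (A ∨' B)
         → (Γ ,, A) ⊢[ R ] C → (Γ ,, B) ⊢[ R ] C → Γ ⊢[ R ] C
    ∀iR  : ∀ {Γ R A} → T (R ∀i) → (↑ Γ) ⊢[ R ] A → Γ ⊢[ R ] (∀' A)
    ∀eR  : ∀ {Γ R A} → T (R ∀e) → Γ ⊢[ R ] (∀' A) → (t : Term) → Γ ⊢[ R ] (A [ t ])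
    ∃iR  : ∀ {Γ R A} → T (R ∃i) → (t : Term) → Γ ⊢[ R ] (A [ t ]) → Γ ⊢[ R ] (∃' A)
    ∃eR  : ∀ {Γ R A C} → T (R ∃e) → Γ ⊢[ R ] (∃' A)
         → ((↑ Γ) ,, A) ⊢[ R ] shiftF C → Γ ⊢[ R ] C

  NM : RuleSet
  NM raa = false
  NM efq = false
  NM _   = true

  NK : RuleSet
  NK raa = true
  NK r   = NM r

  D : RuleSet
  D →i = false
  D →e = false
  D ∀i = false
  D ∀e = false
  D r  = NM r

  _ᵐ : Formula → Formula
  atom p ts ᵐ = atom p ts
  ⊤' ᵐ = ⊤'
  ⊥' ᵐ = ⊥'
  (¬' A) ᵐ = ¬' (A ᵐ)
  (A ∧' B) ᵐ = (A ᵐ) ∧' (B ᵐ)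
  (A ∨' B) ᵐ = (A ᵐ) ∨' (B ᵐ)
  (A ⇒ B) ᵐ = (¬' (A ᵐ)) ∨' (B ᵐ)
  (∀' A) ᵐ = ¬' (∃' (¬' (A ᵐ)))
  (∃' A) ᵐ = ∃' (A ᵐ)

  _ᵐˢ : FSet → FSet
  (Γ ᵐˢ) B = Σ Formula λ A → Γ A × (B ≡ A ᵐ)

  NoImpAll : Formula → Set
  NoImpAll (atom p ts) = ⊤
  NoImpAll ⊤' = ⊤
  NoImpAll ⊥' = ⊤
  NoImpAll (¬' A) = NoImpAll A
  NoImpAll (A ∧' B) = NoImpAll A × NoImpAll B
  NoImpAll (A ∨' B) = NoImpAll A × NoImpAll B
  NoImpAll (A ⇒ B) = ⊥
  NoImpAll (∀' A) = ⊥
  NoImpAll (∃' A) = NoImpAll A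

-- Every NK rule is simulated, in double-negated form, by a short D-derivation on
-- translated formulas: ¬¬ is a monad in minimal logic (¬¬¬A ⊢ ¬A), raa becomes ¬i
-- under ¬¬, and the translation removes → and ∀ in favour of ¬, ∨ and ∃, so that
-- their introductions and eliminations become derivable from the remaining rules.
-- When → and ∀ do not occur, the translation is the identity and Glivenko's
-- theorem for this fragment follows.
module Submission where

open import Defs
open import Data.Bool using (T)
open import Data.Product using (_×_; _,_)
open import Data.Sum using (inj₁; inj₂)
open import Data.Unit using (tt)
open import Function using (_∘_)
open import Relation.Binary.PropositionalEquality using (_≡_; refl; sym; cong; cong₂; subst)

module Derivations (S : Signature) where
  open FOL S

  private variable
    Γ Δ Θ : FSet
    A B C : Formula
    R R′ : RuleSet

  -- A record rather than a function type, so that Γ and Δ can be inferred.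
  record _⊆_ (Γ Δ : FSet) : Set where
    constructor ⊆-intro
    field ⊆-elim : ∀ {B} → Γ B → Δ B
  open _⊆_

  _⊑_ : RuleSet → RuleSet → Set
  R ⊑ R′ = ∀ r → T (R r) → T (R′ r)

  ⊆-refl : Γ ⊆ Γ
  ⊆-refl = ⊆-intro λ γ → γ

  ⊆-trans : Γ ⊆ Δ → Δ ⊆ Θ → Γ ⊆ Θ
  ⊆-trans (⊆-intro f) (⊆-intro g) = ⊆-intro (g ∘ f)

  ⊆-,, : Γ ⊆ (Γ ,, A)
  ⊆-,, = ⊆-intro inj₁

  ,,-mono : Γ ⊆ Δ → (Γ ,, A) ⊆ (Δ ,, A)
  ,,-mono Γ⊆Δ = ⊆-intro λ { (inj₁ γ) → inj₁ (⊆-elim Γ⊆Δ γ) ; (inj₂ eq) → inj₂ eq }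

  ↑-mono : Γ ⊆ Δ → (↑ Γ) ⊆ (↑ Δ)
  ↑-mono Γ⊆Δ = ⊆-intro λ { (C , γ , eq) → C , ⊆-elim Γ⊆Δ γ , eq }

  ⊢-mono : R ⊑ R′ → Γ ⊆ Δ → Γ ⊢[ R ] A → Δ ⊢[ R′ ] A
  ⊢-mono r s (ass γ) = ass (⊆-elim s γ)
  ⊢-mono r s (raaR p d) = raaR (r raa p) (⊢-mono r (,,-mono s) d)
  ⊢-mono r s (efqR p d) = efqR (r efq p) (⊢-mono r s d)
  ⊢-mono r s (⊤iR p) = ⊤iR (r ⊤i p)
  ⊢-mono r s (¬iR p d) = ¬iR (r ¬i p) (⊢-mono r (,,-mono s) d)
  ⊢-mono r s (¬eR p d e) = ¬eR (r ¬e p) (⊢-mono r s d) (⊢-mono r s e)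
  ⊢-mono r s (→iR p d) = →iR (r →i p) (⊢-mono r (,,-mono s) d)
  ⊢-mono r s (→eR p d e) = →eR (r →e p) (⊢-mono r s d) (⊢-mono r s e)
  ⊢-mono r s (∧iR p d e) = ∧iR (r ∧i p) (⊢-mono r s d) (⊢-mono r s e)
  ⊢-mono r s (∧e₁R p d) = ∧e₁R (r ∧e₁ p) (⊢-mono r s d)
  ⊢-mono r s (∧e₂R p d) = ∧e₂R (r ∧e₂ p) (⊢-mono r s d)
  ⊢-mono r s (∨i₁R p d) = ∨i₁R (r ∨i₁ p) (⊢-mono r s d)
  ⊢-mono r s (∨i₂R p d) = ∨i₂R (r ∨i₂ p) (⊢-mono r s d)
  ⊢-mono r s (∨eR p d e f) =
    ∨eR (r ∨e p) (⊢-mono r s d) (⊢-mono r (,,-mono s) e) (⊢-mono r (,,-mono s) f)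
  ⊢-mono r s (∀iR p d) = ∀iR (r ∀i p) (⊢-mono r (↑-mono s) d)
  ⊢-mono r s (∀eR p d t) = ∀eR (r ∀e p) (⊢-mono r s d) t
  ⊢-mono r s (∃iR p t d) = ∃iR (r ∃i p) t (⊢-mono r s d)
  ⊢-mono r s (∃eR p d e) = ∃eR (r ∃e p) (⊢-mono r s d) (⊢-mono r (,,-mono (↑-mono s)) e)

  ⊑-refl : R ⊑ R
  ⊑-refl r p = p

  weaken : Γ ⊆ Δ → Γ ⊢[ R ] A → Δ ⊢[ R ] A
  weaken = ⊢-mono ⊑-refl

  wk : Γ ⊢[ R ] A → (Γ ,, B) ⊢[ R ] A
  wk = weaken ⊆-,,

  hyp₀ : (Γ ,, A) ⊢[ R ] A
  hyp₀ = ass (inj₂ refl)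

  hyp₁ : ((Γ ,, A) ,, B) ⊢[ R ] A
  hyp₁ = ass (inj₁ (inj₂ refl))

  hyp₂ : (((Γ ,, A) ,, B) ,, C) ⊢[ R ] A
  hyp₂ = ass (inj₁ (inj₁ (inj₂ refl)))

  D⊑NM : D ⊑ NM
  D⊑NM raa ()
  D⊑NM efq ()
  D⊑NM ⊤i p = p
  D⊑NM ¬i p = p
  D⊑NM ¬e p = p
  D⊑NM →i ()
  D⊑NM →e ()
  D⊑NM ∧i p = p
  D⊑NM ∧e₁ p = p
  D⊑NM ∧e₂ p = p
  D⊑NM ∨i₁ p = p
  D⊑NM ∨i₂ p = p
  D⊑NM ∨e p = p
  D⊑NM ∀i ()
  D⊑NM ∀e ()
  D⊑NM ∃i p = p
  D⊑NM ∃e p = p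

  NM⊑NK : NM ⊑ NK
  NM⊑NK raa ()
  NM⊑NK efq ()
  NM⊑NK ⊤i p = p
  NM⊑NK ¬i p = p
  NM⊑NK ¬e p = p
  NM⊑NK →i p = p
  NM⊑NK →e p = p
  NM⊑NK ∧i p = p
  NM⊑NK ∧e₁ p = p
  NM⊑NK ∧e₂ p = p
  NM⊑NK ∨i₁ p = p
  NM⊑NK ∨i₂ p = p
  NM⊑NK ∨e p = p
  NM⊑NK ∀i p = p
  NM⊑NK ∀e p = p
  NM⊑NK ∃i p = p
  NM⊑NK ∃e p = p

  NM⇒NK : Γ ⊢[ NM ] A → Γ ⊢[ NK ] A
  NM⇒NK = ⊢-mono NM⊑NK ⊆-refl

  ¬¬-elim : Γ ⊢[ NK ] (¬' (¬' A)) → Γ ⊢[ NK ] A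
  ¬¬-elim d = raaR tt (¬eR tt (wk d) hyp₀)

  module Negation {R : RuleSet} (¬i∈R : T (R ¬i)) (¬e∈R : T (R ¬e)) where

    ¬¬-intro : Γ ⊢[ R ] A → Γ ⊢[ R ] (¬' (¬' A))
    ¬¬-intro d = ¬iR ¬i∈R (¬eR ¬e∈R hyp₀ (wk d))

    ¬¬¬⇒¬ : Γ ⊢[ R ] (¬' (¬' (¬' A))) → Γ ⊢[ R ] (¬' A)
    ¬¬¬⇒¬ d = ¬iR ¬i∈R (¬eR ¬e∈R (wk d) (¬¬-intro hyp₀))

    ¬¬⊥⇒⊥ : Γ ⊢[ R ] (¬' (¬' ⊥')) → Γ ⊢[ R ] ⊥'
    ¬¬⊥⇒⊥ d = ¬eR ¬e∈R d (¬iR ¬i∈R hyp₀)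

    ¬¬⇒¬-absurd : Γ ⊢[ R ] (¬' (¬' A)) → (Γ ,, (¬' A)) ⊢[ R ] ⊥'
    ¬¬⇒¬-absurd d = ¬eR ¬e∈R (wk d) hyp₀

    ¬¬-map : (Γ ,, A) ⊢[ R ] B → Γ ⊢[ R ] (¬' (¬' A)) → Γ ⊢[ R ] (¬' (¬' B))
    ¬¬-map f d = ¬iR ¬i∈R (¬eR ¬e∈R (wk d) (¬iR ¬i∈R (¬eR ¬e∈R hyp₁ (weaken (,,-mono ⊆-,,) f))))

    ¬¬-bind : (Γ ,, A) ⊢[ R ] (¬' (¬' B)) → Γ ⊢[ R ] (¬' (¬' A)) → Γ ⊢[ R ] (¬' (¬' B))
    ¬¬-bind f = ¬¬¬⇒¬ ∘ ¬¬-map f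

  open Negation {D} tt tt public

  ∧i-¬¬ : Γ ⊢[ D ] (¬' (¬' A)) → Γ ⊢[ D ] (¬' (¬' B)) → Γ ⊢[ D ] (¬' (¬' (A ∧' B)))
  ∧i-¬¬ a b = ¬¬-bind (¬¬-map (∧iR tt hyp₁ hyp₀) (wk b)) a

  ∨e-¬¬ : Γ ⊢[ D ] (¬' (¬' (A ∨' B))) → (Γ ,, A) ⊢[ D ] (¬' (¬' C)) → (Γ ,, B) ⊢[ D ] (¬' (¬' C))
        → Γ ⊢[ D ] (¬' (¬' C))
  ∨e-¬¬ d e f = ¬¬-bind (∨eR tt hyp₀ (weaken (,,-mono ⊆-,,) e) (weaken (,,-mono ⊆-,,) f)) d

  →i-¬¬ : (Γ ,, A) ⊢[ D ] (¬' (¬' B)) → Γ ⊢[ D ] (¬' (¬' ((¬' A) ∨' B)))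
  →i-¬¬ d =
    ¬iR tt (¬eR tt hyp₀ (∨i₁R tt (¬iR tt
      (¬eR tt (weaken (,,-mono ⊆-,,) d) (¬iR tt (¬eR tt hyp₂ (∨i₂R tt hyp₀)))))))

  →e-¬¬ : Γ ⊢[ D ] (¬' (¬' ((¬' A) ∨' B))) → Γ ⊢[ D ] (¬' (¬' A)) → Γ ⊢[ D ] (¬' (¬' B))
  →e-¬¬ f a = ¬¬-bind (∨eR tt hyp₀ (¬iR tt (¬eR tt (wk (wk (wk a))) hyp₁)) (¬¬-intro hyp₀)) f

  ∀i-¬¬ : (↑ Γ) ⊢[ D ] (¬' (¬' A)) → Γ ⊢[ D ] (¬' (¬' (¬' (∃' (¬' A)))))
  ∀i-¬¬ d = ¬¬-intro (¬iR tt (∃eR tt hyp₀ (¬eR tt (weaken (⊆-trans (↑-mono ⊆-,,) ⊆-,,) d) hyp₀)))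

  ∀e-¬¬ : ∀ t → Γ ⊢[ D ] (¬' (¬' (¬' (∃' (¬' A))))) → Γ ⊢[ D ] (¬' (¬' (A [ t ])))
  ∀e-¬¬ t d = ¬iR tt (¬eR tt (wk (¬¬¬⇒¬ d)) (∃iR tt t hyp₀))

  ∃i-¬¬ : ∀ t → Γ ⊢[ D ] (¬' (¬' (A [ t ]))) → Γ ⊢[ D ] (¬' (¬' (∃' A)))
  ∃i-¬¬ t = ¬¬-map (∃iR tt t hyp₀)

  ∃e-¬¬ : Γ ⊢[ D ] (¬' (¬' (∃' A))) → ((↑ Γ) ,, A) ⊢[ D ] (¬' (¬' (shiftF C))) → Γ ⊢[ D ] (¬' (¬' C))
  ∃e-¬¬ {C = C} d e =
    ¬iR tt (¬eR tt (wk d) (¬iR tt (∃eR tt hyp₀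
      (¬eR tt (weaken (,,-mono (↑-mono (⊆-trans ⊆-,, ⊆-,,))) e)
              -- ¬ shiftF C is the shifted copy of the discharged ¬ C
              (ass (inj₁ ((¬' C) , inj₁ (inj₂ refl) , refl)))))))

  cast : A ≡ B → Γ ⊢[ R ] A → Γ ⊢[ R ] B
  cast {Γ = Γ} {R = R} = subst (Γ ⊢[ R ]_)

  ᵐ-subF : ∀ σ A → subF σ (A ᵐ) ≡ subF σ A ᵐ
  ᵐ-subF σ (atom p ts) = refl
  ᵐ-subF σ ⊤' = refl
  ᵐ-subF σ ⊥' = refl
  ᵐ-subF σ (¬' A) = cong ¬'_ (ᵐ-subF σ A)
  ᵐ-subF σ (A ∧' B) = cong₂ _∧'_ (ᵐ-subF σ A) (ᵐ-subF σ B)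
  ᵐ-subF σ (A ∨' B) = cong₂ _∨'_ (ᵐ-subF σ A) (ᵐ-subF σ B)
  ᵐ-subF σ (A ⇒ B) = cong₂ (λ A′ B′ → (¬' A′) ∨' B′) (ᵐ-subF σ A) (ᵐ-subF σ B)
  ᵐ-subF σ (∀' A) = cong (λ A′ → ¬' (∃' (¬' A′))) (ᵐ-subF (liftS σ) A)
  ᵐ-subF σ (∃' A) = cong ∃' (ᵐ-subF (liftS σ) A)

  ᵐˢ-,, : ((Γ ,, A) ᵐˢ) ⊆ ((Γ ᵐˢ) ,, (A ᵐ))
  ᵐˢ-,, = ⊆-intro λ { (C , inj₁ γ , eq) → inj₁ (C , γ , eq) ; (C , inj₂ refl , eq) → inj₂ eq }

  ᵐˢ-↑ : ((↑ Γ) ᵐˢ) ⊆ (↑ (Γ ᵐˢ))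
  ᵐˢ-↑ = ⊆-intro λ { (C , (C′ , γ , refl) , refl) → (C′ ᵐ) , (C′ , γ , refl) , sym (ᵐ-subF _ C′) }

  ⊢NK⇒⊢D¬¬ᵐ : Γ ⊢[ NK ] A → (Γ ᵐˢ) ⊢[ D ] (¬' (¬' (A ᵐ)))
  ⊢NK⇒⊢D¬¬ᵐ (ass γ) = ¬¬-intro (ass (_ , γ , refl))
  ⊢NK⇒⊢D¬¬ᵐ (raaR _ d) = ¬iR tt (¬¬⊥⇒⊥ (weaken ᵐˢ-,, (⊢NK⇒⊢D¬¬ᵐ d)))
  ⊢NK⇒⊢D¬¬ᵐ (efqR () _)
  ⊢NK⇒⊢D¬¬ᵐ (⊤iR _) = ¬¬-intro (⊤iR tt)
  ⊢NK⇒⊢D¬¬ᵐ (¬iR _ d) = ¬¬-intro (¬iR tt (¬¬⊥⇒⊥ (weaken ᵐˢ-,, (⊢NK⇒⊢D¬¬ᵐ d))))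
  ⊢NK⇒⊢D¬¬ᵐ (¬eR _ d e) = ¬¬-intro (¬eR tt (⊢NK⇒⊢D¬¬ᵐ e) (¬¬¬⇒¬ (⊢NK⇒⊢D¬¬ᵐ d)))
  ⊢NK⇒⊢D¬¬ᵐ (→iR _ d) = →i-¬¬ (weaken ᵐˢ-,, (⊢NK⇒⊢D¬¬ᵐ d))
  ⊢NK⇒⊢D¬¬ᵐ (→eR _ d e) = →e-¬¬ (⊢NK⇒⊢D¬¬ᵐ d) (⊢NK⇒⊢D¬¬ᵐ e)
  ⊢NK⇒⊢D¬¬ᵐ (∧iR _ d e) = ∧i-¬¬ (⊢NK⇒⊢D¬¬ᵐ d) (⊢NK⇒⊢D¬¬ᵐ e)
  ⊢NK⇒⊢D¬¬ᵐ (∧e₁R _ d) = ¬¬-map (∧e₁R tt hyp₀) (⊢NK⇒⊢D¬¬ᵐ d)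
  ⊢NK⇒⊢D¬¬ᵐ (∧e₂R _ d) = ¬¬-map (∧e₂R tt hyp₀) (⊢NK⇒⊢D¬¬ᵐ d)
  ⊢NK⇒⊢D¬¬ᵐ (∨i₁R _ d) = ¬¬-map (∨i₁R tt hyp₀) (⊢NK⇒⊢D¬¬ᵐ d)
  ⊢NK⇒⊢D¬¬ᵐ (∨i₂R _ d) = ¬¬-map (∨i₂R tt hyp₀) (⊢NK⇒⊢D¬¬ᵐ d)
  ⊢NK⇒⊢D¬¬ᵐ (∨eR _ d e f) =
    ∨e-¬¬ (⊢NK⇒⊢D¬¬ᵐ d) (weaken ᵐˢ-,, (⊢NK⇒⊢D¬¬ᵐ e)) (weaken ᵐˢ-,, (⊢NK⇒⊢D¬¬ᵐ f))
  ⊢NK⇒⊢D¬¬ᵐ (∀iR _ d) = ∀i-¬¬ (weaken ᵐˢ-↑ (⊢NK⇒⊢D¬¬ᵐ d))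
  ⊢NK⇒⊢D¬¬ᵐ (∀eR {A = A} _ d t) =
    cast (cong (¬'_ ∘ ¬'_) (ᵐ-subF _ A)) (∀e-¬¬ t (⊢NK⇒⊢D¬¬ᵐ d))
  ⊢NK⇒⊢D¬¬ᵐ (∃iR {A = A} _ t d) =
    ∃i-¬¬ t (cast (cong (¬'_ ∘ ¬'_) (sym (ᵐ-subF _ A))) (⊢NK⇒⊢D¬¬ᵐ d))
  ⊢NK⇒⊢D¬¬ᵐ (∃eR {C = C} _ d e) =
    ∃e-¬¬ (⊢NK⇒⊢D¬¬ᵐ d)
          (cast (cong (¬'_ ∘ ¬'_) (sym (ᵐ-subF _ C)))
                (weaken (⊆-trans ᵐˢ-,, (,,-mono ᵐˢ-↑)) (⊢NK⇒⊢D¬¬ᵐ e)))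

  ᵐ-id : NoImpAll A → A ᵐ ≡ A
  ᵐ-id {atom p ts} _ = refl
  ᵐ-id {⊤'} _ = refl
  ᵐ-id {⊥'} _ = refl
  ᵐ-id {¬' A} A-free = cong ¬'_ (ᵐ-id A-free)
  ᵐ-id {A ∧' B} (A-free , B-free) = cong₂ _∧'_ (ᵐ-id A-free) (ᵐ-id B-free)
  ᵐ-id {A ∨' B} (A-free , B-free) = cong₂ _∨'_ (ᵐ-id A-free) (ᵐ-id B-free)
  ᵐ-id {∃' A} A-free = cong ∃' (ᵐ-id A-free)

  ᵐˢ-id : (∀ B → Γ B → NoImpAll B) → (Γ ᵐˢ) ⊆ Γ
  ᵐˢ-id {Γ} Γ-free = ⊆-intro λ { (B , γ , refl) → subst Γ (sym (ᵐ-id (Γ-free B γ))) γ }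

  ⊢Dᵐ⇒⊢NM : (∀ B → Γ B → NoImpAll B) → NoImpAll A → (Γ ᵐˢ) ⊢[ D ] (A ᵐ) → Γ ⊢[ NM ] A
  ⊢Dᵐ⇒⊢NM Γ-free A-free d = cast (ᵐ-id A-free) (⊢-mono D⊑NM (ᵐˢ-id Γ-free) d)

  module NM-Negation = Negation {NM} tt tt

  glivenko : (∀ B → Γ B → NoImpAll B) → NoImpAll A → Γ ⊢[ NK ] A → Γ ⊢[ NM ] (¬' (¬' A))
  glivenko {A = A} Γ-free A-free = ⊢Dᵐ⇒⊢NM {A = ¬' (¬' A)} Γ-free A-free ∘ ⊢NK⇒⊢D¬¬ᵐ

  glivenko-¬ : (∀ B → Γ B → NoImpAll B) → NoImpAll A → Γ ⊢[ NK ] (¬' A) → Γ ⊢[ NM ] (¬' A)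
  glivenko-¬ {A = A} Γ-free A-free = ⊢Dᵐ⇒⊢NM {A = ¬' A} Γ-free A-free ∘ ¬¬¬⇒¬ ∘ ⊢NK⇒⊢D¬¬ᵐ

theorem6p4 : (S : Signature) → let open FOL S in
    ((Γ : FSet) (A : Formula) → Γ ⊢[ NK ] A →
       ((Γ ᵐˢ) ⊢[ D ] (¬' (¬' (A ᵐ)))) × (((Γ ᵐˢ) ,, (¬' (A ᵐ))) ⊢[ D ] ⊥'))
    ×
    ((Γ : FSet) (A : Formula) → (∀ B → Γ B → NoImpAll B) → NoImpAll A →
       (((Γ ⊢[ NK ] A) → (Γ ⊢[ NM ] (¬' (¬' A)))) × ((Γ ⊢[ NM ] (¬' (¬' A))) → (Γ ⊢[ NK ] A)))
       × (((Γ ⊢[ NK ] A) → ((Γ ,, (¬' A)) ⊢[ NM ] ⊥')) × (((Γ ,, (¬' A)) ⊢[ NM ] ⊥') → (Γ ⊢[ NK ] A)))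
       × ((B : Formula) → A ≡ (¬' B) →
           ((Γ ⊢[ NK ] (¬' B)) → (Γ ⊢[ NM ] (¬' B))) × ((Γ ⊢[ NM ] (¬' B)) → (Γ ⊢[ NK ] (¬' B)))))
theorem6p4 S =
    (λ _ _ d → ⊢NK⇒⊢D¬¬ᵐ d , ¬¬⇒¬-absurd (⊢NK⇒⊢D¬¬ᵐ d))
  , λ Γ A Γ-free A-free →
        (glivenko Γ-free A-free , ¬¬-elim ∘ NM⇒NK)
      , (NM-Negation.¬¬⇒¬-absurd ∘ glivenko Γ-free A-free , raaR tt ∘ NM⇒NK)
      , λ B A≡¬B → glivenko-¬ Γ-free (subst NoImpAll A≡¬B A-free) , NM⇒NK
  where
    open FOL S
    open Derivations S
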